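{- Let $t\ge 1$ be an integer. For $n\ge 1$, let $g_t(n)$ denote the number of overpartitions of $n$ in which the difference between the largest part and the smallest part is at most $t$, and such that if this difference is exactly $t$, then the largest parts are not overlined. Then, as formal power series in $q$, $$\sum_{n\ge 1} g_t(n) q^n=\frac{1}{1-q^t}\left(\frac{(-q;q)_t}{(q;q)_t}-1\right).$$
   Context: An overpartition of a positive integer $n$ is a partition of $n$ (a non-increasing sequence of positive integers summing to $n$) in which the first occurrence of each distinct part may be overlined. For instance, the overpartitions of $4$ counted by $g_1(4)$ are $4,\ \overline{4},\ 2+2,\ \overline{2}+2,\ 2+1+1,\ 2+\overline{1}+1,\ 1+1+1+1,\ \overline{1}+1+1+1$, so $g_1(4)=8$. Notation: $(a;q)_n=\prod_{k=0}^{n-1}(1-aq^k)$. -}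

module Defs where

open import Data.Nat as ℕ using (ℕ; zero; suc; _≤_; _⊔_; _⊓_; _∸_)
open import Data.Nat.Divisibility using (_∣?_)
open import Data.Integer as ℤ using (ℤ; +_)
open import Data.Bool using (Bool; true; false)
open import Data.List using (List; []; _∷_; map; foldr; length; upTo)
open import Data.Nat.ListAction using (sum)
open import Data.List.Relation.Unary.All using (All)
open import Data.List.Relation.Unary.Unique.Propositional using (Unique)
open import Data.List.Membership.Propositional using (_∈_)
open import Data.Product using (Σ; _×_; proj₁; proj₂; _,_)
open import Data.Unit using (⊤)
open import Relation.Binary.PropositionalEquality using (_≡_; _≢_)
open import Relation.Nullary using (¬_)
open import Relation.Nullary.Decidable using (⌊_⌋)
open import Function.Bundles using (_⇔_)

-- Overpartitions
-- An overpartition is written as a list of entries (part , overlined?)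
-- read left to right: λ₁ ≥ λ₂ ≥ … ≥ λ_k ≥ 1.

Entry : Set
Entry = ℕ × Bool

NonIncreasing : List Entry → Set
NonIncreasing []                        = ⊤
NonIncreasing (x ∷ [])                  = ⊤
NonIncreasing (x ∷ y ∷ ys) = (proj₁ y ≤ proj₁ x) × NonIncreasing (y ∷ ys)

-- only the first occurrence of each distinct part may be overlined:
-- (in a non-increasing list, equal parts are contiguous) whenever an entry
-- has the same part as its predecessor, it is not overlined.
FirstOccOverlined : List Entry → Set
FirstOccOverlined []           = ⊤
FirstOccOverlined (x ∷ [])     = ⊤
FirstOccOverlined (x ∷ y ∷ ys) =
  (proj₁ y ≡ proj₁ x → proj₂ y ≡ false) × FirstOccOverlined (y ∷ ys)

parts : List Entry → List ℕ
parts = map proj₁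

IsOverpartition : ℕ → List Entry → Set
IsOverpartition n L =
  All (λ e → 1 ≤ proj₁ e) L × NonIncreasing L × FirstOccOverlined L
  × sum (parts L) ≡ n

largest : List Entry → ℕ
largest L = foldr _⊔_ 0 (parts L)

smallest : List Entry → ℕ
smallest []      = 0
smallest (x ∷ L) = foldr _⊓_ (proj₁ x) (parts L)

IsGOverpartition : ℕ → ℕ → List Entry → Set
IsGOverpartition t n L =
  IsOverpartition n L
  × largest L ∸ smallest L ≤ t
  × (largest L ∸ smallest L ≡ t →
       All (λ e → proj₁ e ≡ largest L → proj₂ e ≡ false) L)

HasCount : {A : Set} → (A → Set) → ℕ → Set
HasCount {A} P k =
  Σ (List A) λ xs → Unique xs × (∀ x → (x ∈ xs) ⇔ P x) × length xs ≡ k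

G : ℕ → ℕ → ℕ → Set
G t n k = HasCount (IsGOverpartition t n) k

FPS : Set
FPS = ℕ → ℤ

oneₛ : FPS
oneₛ zero    = + 1
oneₛ (suc _) = + 0

_-ₛ_ : FPS → FPS → FPS
(f -ₛ g) n = f n ℤ.- g n

_*ₛ_ : FPS → FPS → FPS
(f *ₛ g) n = foldr ℤ._+_ (+ 0) (map (λ i → f i ℤ.* g (n ∸ i)) (upTo (suc n)))

infixl 7 _*ₛ_
infixl 6 _-ₛ_

onePlusQ^ : ℕ → FPS
onePlusQ^ k n = oneₛ n ℤ.+ (if ⌊ n ℕ.≟ k ⌋ then + 1 else + 0)
  where open import Data.Bool using (if_then_else_)

-- 1/(1 - q^k) = Σ_{m ≥ 0} q^{k m}   (used for k ≥ 1)
geom : ℕ → FPS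
geom k n = if ⌊ k ∣? n ⌋ then + 1 else + 0
  where open import Data.Bool using (if_then_else_)

negQPoch : ℕ → FPS
negQPoch zero    = oneₛ
negQPoch (suc t) = negQPoch t *ₛ onePlusQ^ (suc t)

invQPoch : ℕ → FPS
invQPoch zero    = oneₛ
invQPoch (suc t) = invQPoch t *ₛ geom (suc t)

rhs : ℕ → FPS
rhs t = geom t *ₛ (negQPoch t *ₛ invQPoch t -ₛ oneₛ)

-- By the product formula, (-q;q)_t/(q;q)_t counts overpartitions with all parts at
-- most t: for each k ≤ t choose whether an overlined k occurs and how many plain copies of k occur.
-- Subtracting 1 discards the empty overpartition, and the factor 1/(1-q^t) contributes a number m.
-- A pair (m, μ) is sent to the overpartition obtained from μ by m times removing the smallest part
-- and putting it back, increased by t, as the new largest part (keeping its overline). This step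
-- preserves exactly the condition defining g_t, namely that the smallest part raised by t may
-- precede the largest part; conversely, undoing it while the largest part exceeds t recovers (m, μ).
module Submission where

open import Defs

open import Algebra.Properties.CommutativeSemigroup using (interchange)
open import Data.Bool using (Bool; true; false; if_then_else_)
open import Data.Empty using (⊥; ⊥-elim)
open import Data.Integer as ℤ using (ℤ; +_)
import Data.Integer.Properties as ℤ
open import Data.List
  using (List; []; _∷_; [_]; _++_; _∷ʳ_; map; foldr; length; concatMap; upTo; cartesianProduct; replicate)
open import Data.List.Membership.Propositional using (_∈_; find; lose)
open import Data.List.Membership.Propositional.Properties
  using (∈-map⁺; ∈-map⁻; ∈-concatMap⁺; ∈-concatMap⁻; ∈-cartesianProduct⁺; ∈-cartesianProduct⁻; ∈-upTo⁺; ∈-upTo⁻)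
open import Data.List.Properties using (length-map; length-++; map-∘; map-id-local; map-++)
open import Data.List.Relation.Binary.Disjoint.Propositional using (Disjoint)
open import Data.List.Relation.Unary.All as All using (All; []; _∷_)
import Data.List.Relation.Unary.All.Properties as All
import Data.List.Relation.Unary.AllPairs as AllPairs
import Data.List.Relation.Unary.AllPairs.Properties as AllPairs
open import Data.List.Relation.Unary.Any using (here; there)
open import Data.List.Relation.Unary.Linked as Linked using (Linked; []; [-]; _∷_)
open import Data.List.Relation.Unary.Unique.Propositional using (Unique; []; _∷_)
import Data.List.Relation.Unary.Unique.Propositional.Properties as Unique
open import Data.Nat
  using (ℕ; zero; suc; _+_; _*_; _∸_; _≤_; _<_; _⊔_; _⊓_; s≤s; z≤n; _≟_; _<?_; NonZero; >-nonZero⁻¹)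
open import Data.Nat.Divisibility using (_∣?_; divides)
open import Data.Nat.ListAction using (sum)
open import Data.Nat.ListAction.Properties using (sum-++)
open import Data.Nat.Properties
open import Data.Product using (Σ; _×_; _,_; proj₁; proj₂; ∃-syntax; map₁; uncurry)
open import Data.Unit using (⊤; tt)
open import Function using (_∘_)
open import Function.Bundles using (_⇔_; mk⇔; Equivalence)
open import Function.Construct.Composition using (_⇔-∘_)
open import Function.Construct.Symmetry using (⇔-sym)
open import Relation.Binary.PropositionalEquality
  using (_≡_; _≢_; refl; sym; trans; cong; cong₂; subst; module ≡-Reasoning)
open import Relation.Nullary using (¬_; yes; no)

open Equivalence using (to; from)

private
  variable
    A B C : Set
    P : A → Set
    Q : B → Set
    k : ℕ
    x y : A
    xs ys : List A

Counts : (A → ℕ) → (A → Set) → FPS → Set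
Counts size P f = ∀ n → ∃[ k ] HasCount (λ a → P a × size a ≡ n) k × + k ≡ f n

HasCount-resp : (∀ x → P x ⇔ Q x) → HasCount P k → HasCount Q k
HasCount-resp P⇔Q (xs , u , complete , len) = xs , u , (λ x → P⇔Q x ⇔-∘ complete x) , len

HasCount-[] : (∀ x → ¬ P x) → HasCount P 0
HasCount-[] ¬P = [] , [] , (λ x → mk⇔ (λ ()) (⊥-elim ∘ ¬P x)) , refl

HasCount-[_] : (a : A) → (∀ x → P x ⇔ x ≡ a) → HasCount P 1
HasCount-[ a ] P⇔≡a = [ a ] , [] ∷ [] ,
  (λ x → mk⇔ (λ { (here refl) → from (P⇔≡a a) refl }) (λ px → here (to (P⇔≡a x) px))) , refl

Counts-resp : ∀ {size : A → ℕ} {f} → (∀ a → P a ⇔ Q a) → Counts size P f → Counts size Q f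
Counts-resp P⇔Q count n with k , enum , k≡fn ← count n =
  k , HasCount-resp (λ a → mk⇔ (λ (pa , sa) → to (P⇔Q a) pa , sa) (λ (qa , sa) → from (P⇔Q a) qa , sa)) enum , k≡fn

record SizedBijection (sizeA : A → ℕ) (P : A → Set) (sizeB : B → ℕ) (Q : B → Set) : Set where
  field
    encode        : A → B
    decode        : B → A
    encode-pres   : ∀ {a} → P a → Q (encode a)
    decode-pres   : ∀ {b} → Q b → P (decode b)
    encode-size   : ∀ {a} → P a → sizeB (encode a) ≡ sizeA a
    decode∘encode : ∀ {a} → P a → decode (encode a) ≡ a
    encode∘decode : ∀ {b} → Q b → encode (decode b) ≡ b

  decode-size : ∀ {b} → Q b → sizeA (decode b) ≡ sizeB b
  decode-size qb = trans (sym (encode-size (decode-pres qb))) (cong sizeB (encode∘decode qb))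

Counts-transport : ∀ {sizeA sizeB f} → SizedBijection {A} {B} sizeA P sizeB Q →
                   Counts sizeA P f → Counts sizeB Q f
Counts-transport {A} {B} {P} {Q} {sizeA} {sizeB} bij count n
  with k , (xs , u , complete , len) , k≡fn ← count n =
  k , (map encode xs , unique , complete′ , trans (length-map encode xs) len) , k≡fn
  where
  open SizedBijection bij
  valid : ∀ {a} → a ∈ xs → P a × sizeA a ≡ n
  valid {a} = to (complete a)

  unique : Unique (map encode xs)
  unique = Unique.map⁻ (subst Unique (sym decode∘encode-xs) u)
    where
    decode∘encode-xs : map decode (map encode xs) ≡ xs
    decode∘encode-xs = trans (sym (map-∘ xs)) (map-id-local (All.tabulate (decode∘encode ∘ proj₁ ∘ valid)))

  complete′ : ∀ b → b ∈ map encode xs ⇔ (Q b × sizeB b ≡ n)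
  complete′ b = mk⇔ ⇒ ⇐
    where
    ⇒ : b ∈ map encode xs → Q b × sizeB b ≡ n
    ⇒ b∈ with a , a∈ , refl ← ∈-map⁻ encode b∈ with pa , sa ← valid a∈ = encode-pres pa , trans (encode-size pa) sa
    ⇐ : Q b × sizeB b ≡ n → b ∈ map encode xs
    ⇐ (qb , sb) = subst (_∈ map encode xs) (encode∘decode qb)
      (∈-map⁺ encode (from (complete (decode b)) (decode-pres qb , trans (decode-size qb) sb)))

unique-concatMap : ∀ {h : A → List C} {is} (key : C → A) → Unique is → (∀ i → Unique (h i)) →
                   (∀ {i z} → z ∈ h i → key z ≡ i) → Unique (concatMap h is)
unique-concatMap {h = h} key u uh key-h =
  Unique.concat⁺ (All.map⁺ (All.universal uh _)) (AllPairs.map⁺ (AllPairs.map disjoint u))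
  where
  disjoint : ∀ {i j} → i ≢ j → Disjoint (h i) (h j)
  disjoint i≢j (z∈hi , z∈hj) = i≢j (trans (sym (key-h z∈hi)) (key-h z∈hj))

module Enumerated {size : A → ℕ} {f : FPS} (count : Counts size P f) (n : ℕ) where
  elems : List A
  elems = proj₁ (proj₁ (proj₂ (count n)))

  unique : Unique elems
  unique = proj₁ (proj₂ (proj₁ (proj₂ (count n))))

  ∈⇔ : ∀ a → a ∈ elems ⇔ (P a × size a ≡ n)
  ∈⇔ = proj₁ (proj₂ (proj₂ (proj₁ (proj₂ (count n)))))

  length≡ : + length elems ≡ f n
  length≡ = trans (cong +_ (proj₂ (proj₂ (proj₂ (proj₁ (proj₂ (count n))))))) (proj₂ (proj₂ (count n)))

length-cartesianProduct : (xs : List A) (ys : List B) →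
                          length (cartesianProduct xs ys) ≡ length xs * length ys
length-cartesianProduct []       ys = refl
length-cartesianProduct (x ∷ xs) ys = trans (length-++ (map (x ,_) ys))
  (cong₂ _+_ (length-map (x ,_) ys) (length-cartesianProduct xs ys))

length-concatMap : (h : A → List C) (w : A → ℤ) → (∀ i → + length (h i) ≡ w i) →
                   ∀ is → + length (concatMap h is) ≡ foldr ℤ._+_ (+ 0) (map w is)
length-concatMap h w length-h []       = refl
length-concatMap h w length-h (i ∷ is) = trans (cong +_ (length-++ (h i)))
  (trans (ℤ.pos-+ (length (h i)) _) (cong₂ ℤ._+_ (length-h i) (length-concatMap h w length-h is)))

Counts-* : ∀ {sizeA sizeB f g} → Counts {A} sizeA P f → Counts {B} sizeB Q g →
           Counts (λ (a , b) → sizeA a + sizeB b) (λ (a , b) → P a × Q b) (f *ₛ g)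
Counts-* {A} {P} {B} {Q} {sizeA} {sizeB} {f} {g} countA countB n =
  length pairs , (pairs , unique , complete , refl) , length-pairs
  where
  module EA = Enumerated countA
  module EB = Enumerated countB

  piece : ℕ → List (A × B)
  piece i = cartesianProduct (EA.elems i) (EB.elems (n ∸ i))

  pairs : List (A × B)
  pairs = concatMap piece (upTo (suc n))

  unique : Unique pairs
  unique = unique-concatMap (sizeA ∘ proj₁) (Unique.upTo⁺ (suc n))
    (λ i → Unique.cartesianProduct⁺ (EA.unique i) (EB.unique (n ∸ i)))
    (λ {i} z∈ → proj₂ (to (EA.∈⇔ i _) (proj₁ (∈-cartesianProduct⁻ _ _ z∈))))

  complete : ∀ z → z ∈ pairs ⇔ ((P (proj₁ z) × Q (proj₂ z)) × sizeA (proj₁ z) + sizeB (proj₂ z) ≡ n)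
  complete (a , b) = mk⇔ ⇒ ⇐
    where
    ⇒ : (a , b) ∈ pairs → (P a × Q b) × sizeA a + sizeB b ≡ n
    ⇒ z∈ with i , i∈ , z∈piece ← find (∈-concatMap⁻ piece {xs = upTo (suc n)} z∈)
         with a∈ , b∈ ← ∈-cartesianProduct⁻ _ _ z∈piece
         with pa , refl ← to (EA.∈⇔ i a) a∈
         with qb , sb ← to (EB.∈⇔ (n ∸ i) b) b∈
      = (pa , qb) , trans (cong (_+_ (sizeA a)) sb) (m+[n∸m]≡n (≤-pred (∈-upTo⁻ i∈)))
    ⇐ : (P a × Q b) × sizeA a + sizeB b ≡ n → (a , b) ∈ pairs
    ⇐ ((pa , qb) , refl) = ∈-concatMap⁺ piece (lose (∈-upTo⁺ (s≤s (m≤m+n (sizeA a) (sizeB b))))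
      (∈-cartesianProduct⁺ (from (EA.∈⇔ _ a) (pa , refl))
                           (from (EB.∈⇔ _ b) (qb , sym (m+n∸m≡n (sizeA a) (sizeB b))))))

  length-pairs : + length pairs ≡ (f *ₛ g) n
  length-pairs = length-concatMap piece (λ i → f i ℤ.* g (n ∸ i)) length-piece (upTo (suc n))
    where
    length-piece : ∀ i → + length (piece i) ≡ f i ℤ.* g (n ∸ i)
    length-piece i = trans (cong +_ (length-cartesianProduct (EA.elems i) (EB.elems (n ∸ i))))
      (trans (ℤ.pos-* (length (EA.elems i)) _) (cong₂ ℤ._*_ (EA.length≡ i) (EB.length≡ (n ∸ i))))

length-≡1 : ∀ {a : A} xs → Unique xs → (∀ x → x ∈ xs ⇔ x ≡ a) → length xs ≡ 1
length-≡1 {a = a} []          _                  ∈⇔≡a with () ← from (∈⇔≡a a) refl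
length-≡1         (_ ∷ [])    _                  _    = refl
length-≡1         (x ∷ y ∷ _) ((x≢y ∷ _) ∷ _) ∈⇔≡a =
  ⊥-elim (x≢y (trans (to (∈⇔≡a x) (here refl)) (sym (to (∈⇔≡a y) (there (here refl))))))

Counts-positive : ∀ {size : A → ℕ} {f} (a₀ : A) → P a₀ → size a₀ ≡ 0 → (∀ {a} → P a → size a ≡ 0 → a ≡ a₀) →
                  Counts size P f → Counts size (λ a → P a × 1 ≤ size a) (f -ₛ oneₛ)
Counts-positive {P = P} {size} {f} a₀ pa₀ size-a₀ only-a₀ count zero =
  0 , HasCount-[] (λ a ((_ , 1≤s) , s≡0) → 1+n≰n (subst (1 ≤_) s≡0 1≤s)) , sym f0-1≡0
  where
  module E = Enumerated count
  f0≡1 : f 0 ≡ + 1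
  f0≡1 = trans (sym (E.length≡ 0)) (cong +_ (length-≡1 (E.elems 0) (E.unique 0) λ a →
    mk⇔ (λ a∈ → let pa , sa = to (E.∈⇔ 0 a) a∈ in only-a₀ pa sa) (λ { refl → from (E.∈⇔ 0 a₀) (pa₀ , size-a₀) })))
  f0-1≡0 : f 0 ℤ.- + 1 ≡ + 0
  f0-1≡0 = cong (ℤ._- + 1) f0≡1
Counts-positive {P = P} {size} {f} _ _ _ _ count (suc n) with k , enum , k≡ ← count (suc n) =
  k , HasCount-resp (λ a → mk⇔ (λ (pa , sa) → (pa , subst (1 ≤_) (sym sa) (s≤s z≤n)) , sa)
                               (λ ((pa , _) , sa) → pa , sa)) enum ,
  trans k≡ (sym (ℤ.+-identityʳ (f (suc n))))

Counts-oneₛ : Counts (λ (_ : ⊤) → 0) (λ _ → ⊤) oneₛ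
Counts-oneₛ zero    = 1 , HasCount-[ tt ] (λ _ → mk⇔ (λ _ → refl) (λ _ → tt , refl)) , refl
Counts-oneₛ (suc n) = 0 , HasCount-[] (λ _ ()) , refl

markWeight : ℕ → Bool → ℕ
markWeight k b = if b then k else 0

Counts-onePlusQ^ : ∀ k → Counts (markWeight k) (λ _ → ⊤) (onePlusQ^ k)
Counts-onePlusQ^ zero zero = 2 , (false ∷ true ∷ [] , ((λ ()) ∷ []) ∷ [] ∷ [] ,
  (λ { false → mk⇔ (λ _ → tt , refl) (λ _ → here refl) ; true → mk⇔ (λ _ → tt , refl) (λ _ → there (here refl)) }) ,
  refl) , refl
Counts-onePlusQ^ (suc k) zero = 1 , HasCount-[ false ]
  (λ { false → mk⇔ (λ _ → refl) (λ _ → tt , refl) ; true → mk⇔ (λ ()) (λ ()) }) , refl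
Counts-onePlusQ^ k (suc n) with suc n ≟ k
... | yes refl = 1 , HasCount-[ true ]
  (λ { false → mk⇔ (λ ()) (λ ()) ; true → mk⇔ (λ _ → refl) (λ _ → tt , refl) }) , refl
... | no n+1≢k = 0 , HasCount-[] (λ { false () ; true (_ , k≡n+1) → n+1≢k (sym k≡n+1) }) , refl

Counts-geom : ∀ k .{{_ : NonZero k}} → Counts (_*_ k) (λ _ → ⊤) (geom k)
Counts-geom k n with k ∣? n
... | yes (divides q n≡q*k) = 1 , HasCount-[ q ]
  (λ c → mk⇔ (λ p → *-cancelʳ-≡ c q k (trans (*-comm c k) (trans (proj₂ p) n≡q*k)))
             (λ { refl → tt , sym (trans n≡q*k (*-comm q k)) })) , refl
... | no k∤n = 0 , HasCount-[] (λ c p → k∤n (divides c (trans (sym (proj₂ p)) (*-comm k c)))) , refl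

Tuple : Set → ℕ → Set
Tuple A zero    = ⊤
Tuple A (suc t) = Tuple A t × A

weighted : (ℕ → A → ℕ) → ∀ t → Tuple A t → ℕ
weighted w zero    _        = 0
weighted w (suc t) (as , a) = weighted w t as + w (suc t) a

Counts-negQPoch : ∀ t → Counts (weighted markWeight t) (λ _ → ⊤) (negQPoch t)
Counts-negQPoch zero    = Counts-oneₛ
Counts-negQPoch (suc t) =
  Counts-resp (λ _ → mk⇔ _ _) (Counts-* (Counts-negQPoch t) (Counts-onePlusQ^ (suc t)))

Counts-invQPoch : ∀ t → Counts (weighted _*_ t) (λ _ → ⊤) (invQPoch t)
Counts-invQPoch zero    = Counts-oneₛ
Counts-invQPoch (suc t) = Counts-resp (λ _ → mk⇔ _ _) (Counts-* (Counts-invQPoch t) (Counts-geom (suc t)))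

last′ : A → List A → A
last′ x []       = x
last′ x (y ∷ xs) = last′ y xs

init′ : A → List A → List A
init′ x []       = []
init′ x (y ∷ xs) = x ∷ init′ y xs

∷-init′-last′ : ∀ (x : A) xs → x ∷ xs ≡ init′ x xs ∷ʳ last′ x xs
∷-init′-last′ x []       = refl
∷-init′-last′ x (y ∷ xs) = cong (x ∷_) (∷-init′-last′ y xs)

last′-∷ʳ : ∀ (x : A) xs y → last′ x (xs ∷ʳ y) ≡ y
last′-∷ʳ x []       y = refl
last′-∷ʳ x (z ∷ xs) y = last′-∷ʳ z xs y

init′-∷ʳ : ∀ (x : A) xs y → init′ x (xs ∷ʳ y) ≡ x ∷ xs
init′-∷ʳ x []       y = refl
init′-∷ʳ x (z ∷ xs) y = cong (x ∷_) (init′-∷ʳ z xs y)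

module _ {R : A → A → Set} where

  Linked-∷ʳ⁺ : Linked R (x ∷ xs) → R (last′ x xs) y → Linked R ((x ∷ xs) ∷ʳ y)
  Linked-∷ʳ⁺ [-]        Rxy = Rxy ∷ [-]
  Linked-∷ʳ⁺ (Rxz ∷ Rs) Rly = Rxz ∷ Linked-∷ʳ⁺ Rs Rly

  Linked-∷ʳ⁻ : ∀ {x} xs → Linked R ((x ∷ xs) ∷ʳ y) → Linked R (x ∷ xs) × R (last′ x xs) y
  Linked-∷ʳ⁻ []       (Rxy ∷ [-]) = [-] , Rxy
  Linked-∷ʳ⁻ (z ∷ xs) (Rxz ∷ Rs)  with Rzs , Rly ← Linked-∷ʳ⁻ xs Rs = Rxz ∷ Rzs , Rly

  Linked-++⁻ʳ : ∀ xs → Linked R (xs ++ ys) → Linked R ys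
  Linked-++⁻ʳ []       Rs = Rs
  Linked-++⁻ʳ (x ∷ xs) Rs = Linked-++⁻ʳ xs (Linked.tail Rs)

  Linked-++⁺ : Linked R xs → Linked R ys → All (λ x → All (R x) ys) xs → Linked R (xs ++ ys)
  Linked-++⁺ []         Rys _                  = Rys
  Linked-++⁺ [-]        []  _                  = [-]
  Linked-++⁺ [-]        Rys ((Rxy ∷ _) ∷ [])   = Rxy ∷ Rys
  Linked-++⁺ (Rxz ∷ Rs) Rys (_ ∷ R*)           = Rxz ∷ Linked-++⁺ Rs Rys R*

Follows : Entry → Entry → Set
Follows (a , _) (b , o) = b ≤ a × (b ≡ a → o ≡ false)

Overpartition : List Entry → Set
Overpartition L = All (λ (a , _) → 1 ≤ a) L × Linked Follows L

weight : List Entry → ℕ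
weight L = sum (parts L)

weight-++ : ∀ xs ys → weight (xs ++ ys) ≡ weight xs + weight ys
weight-++ xs ys = trans (cong sum (map-++ proj₁ xs ys)) (sum-++ (parts xs) (parts ys))

weight-∷ʳ : ∀ xs y → weight (xs ∷ʳ y) ≡ weight xs + proj₁ y
weight-∷ʳ xs y = trans (weight-++ xs [ y ]) (cong (_+_ (weight xs)) (+-identityʳ (proj₁ y)))

Follows-< : proj₁ y < proj₁ x → Follows x y
Follows-< y<x = <⇒≤ y<x , λ y≡x → ⊥-elim (<⇒≢ y<x y≡x)

Linked-Follows-++ : ∀ {v} → Linked Follows xs → Linked Follows ys →
                    All (λ (a , _) → v ≤ a) xs → All (λ (b , _) → b < v) ys → Linked Follows (xs ++ ys)
Linked-Follows-++ Fxs Fys v≤xs ys<v = Linked-++⁺ Fxs Fys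
  (All.map (λ {x} v≤a → All.map (λ {y} b<v → Follows-< {y = y} {x = x} (≤-trans b<v v≤a)) ys<v) v≤xs)

Linked-Follows⇒ : ∀ {L} → Linked Follows L → NonIncreasing L × FirstOccOverlined L
Linked-Follows⇒ []                = tt , tt
Linked-Follows⇒ [-]               = tt , tt
Linked-Follows⇒ ((≤a , ≡a⇒o) ∷ F) with ni , fo ← Linked-Follows⇒ F = (≤a , ni) , (≡a⇒o , fo)

Linked-Follows⇐ : ∀ L → NonIncreasing L → FirstOccOverlined L → Linked Follows L
Linked-Follows⇐ []          _         _           = []
Linked-Follows⇐ (x ∷ [])    _         _           = [-]
Linked-Follows⇐ (x ∷ y ∷ L) (≤x , ni) (≡x⇒o , fo) = (≤x , ≡x⇒o) ∷ Linked-Follows⇐ (y ∷ L) ni fo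

IsOverpartition⇔ : ∀ {n} L → IsOverpartition n L ⇔ (Overpartition L × weight L ≡ n)
IsOverpartition⇔ L = mk⇔
  (λ (pos , ni , fo , w) → (pos , Linked-Follows⇐ L ni fo) , w)
  (λ ((pos , F) , w) → let ni , fo = Linked-Follows⇒ F in pos , ni , fo , w)

Follows-≤ : Linked Follows (x ∷ xs) → All (λ (b , _) → b ≤ proj₁ x) xs
Follows-≤ [-]              = []
Follows-≤ ((y≤x , _) ∷ F) = y≤x ∷ All.map (λ z≤y → ≤-trans z≤y y≤x) (Follows-≤ F)

last′-≤ : ∀ xs → Linked Follows (x ∷ xs) → proj₁ (last′ x xs) ≤ proj₁ x
last′-≤ []       _               = ≤-refl
last′-≤ (y ∷ xs) ((y≤x , _) ∷ F) = ≤-trans (last′-≤ xs F) y≤x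

largest-head : Linked Follows (x ∷ xs) → largest (x ∷ xs) ≡ proj₁ x
largest-head {xs = xs} F = m≥n⇒m⊔n≡m (foldr-⊔-≤ xs (Follows-≤ F))
  where
  foldr-⊔-≤ : ∀ {a} ys → All (λ (b , _) → b ≤ a) ys → foldr _⊔_ 0 (parts ys) ≤ a
  foldr-⊔-≤ []       []         = z≤n
  foldr-⊔-≤ (y ∷ ys) (y≤ ∷ ≤s) = ⊔-lub y≤ (foldr-⊔-≤ ys ≤s)

smallest-last′ : ∀ xs → Linked Follows (x ∷ xs) → smallest (x ∷ xs) ≡ proj₁ (last′ x xs)
smallest-last′ []       _              = refl
smallest-last′ {x} (y ∷ xs) ((y≤x , _) ∷ F) = foldr-⊓-last′ xs F y≤x
  where
  foldr-⊓-last′ : ∀ {y b} xs → Linked Follows (y ∷ xs) → proj₁ y ≤ b →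
                  foldr _⊓_ b (parts (y ∷ xs)) ≡ proj₁ (last′ y xs)
  foldr-⊓-last′ []       _              y≤b = m≤n⇒m⊓n≡m y≤b
  foldr-⊓-last′ (z ∷ xs) ((z≤y , _) ∷ F) y≤b =
    trans (cong (_ ⊓_) (foldr-⊓-last′ xs F (≤-trans z≤y y≤b))) (m≥n⇒m⊓n≡n (≤-trans (last′-≤ xs F) z≤y))

repeats-unmarked : Linked Follows (x ∷ xs) → All (λ (b , o) → proj₁ x ≤ b → o ≡ false) xs
repeats-unmarked [-]                   = []
repeats-unmarked ((y≤x , ≡x⇒o) ∷ F) =
  (λ x≤y → ≡x⇒o (≤-antisym y≤x x≤y)) ∷ All.map (λ y≤⇒o x≤ → y≤⇒o (≤-trans y≤x x≤)) (repeats-unmarked F)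

block : ℕ → Bool → ℕ → List Entry
block v true  c = (v , true) ∷ replicate c (v , false)
block v false c = replicate c (v , false)

blocks : ∀ t → Tuple Bool t → Tuple ℕ t → List Entry
blocks zero    _        _        = []
blocks (suc t) (bs , b) (cs , c) = block (suc t) b c ++ blocks t bs cs

run : ℕ → List Entry → ℕ × List Entry
run v []            = 0 , []
run v ((a , o) ∷ L) with a ≟ v
... | yes _ = map₁ suc (run v L)
... | no  _ = 0 , (a , o) ∷ L

unblock : ℕ → List Entry → Bool × ℕ × List Entry
unblock v ((a , true) ∷ L) with a ≟ v
... | yes _ = true , run v L
... | no  _ = false , 0 , (a , true) ∷ L
unblock v L = false , run v L

unblocks : ∀ t → List Entry → Tuple Bool t × Tuple ℕ t
unblocks zero    _ = tt , tt
unblocks (suc t) L =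
  let b , c , R = unblock (suc t) L
      bs , cs   = unblocks t R
  in (bs , b) , (cs , c)

module _ (v : ℕ) where

  replicate-parts : ∀ c → All (λ (a , _) → a ≡ v) (replicate c (v , false))
  replicate-parts zero    = []
  replicate-parts (suc c) = refl ∷ replicate-parts c

  replicate-linked : ∀ c → Linked Follows (replicate c (v , false))
  replicate-linked zero          = []
  replicate-linked (suc zero)    = [-]
  replicate-linked (suc (suc c)) = (≤-refl , λ _ → refl) ∷ replicate-linked (suc c)

  weight-replicate : ∀ c → weight (replicate c (v , false)) ≡ v * c
  weight-replicate zero    = sym (*-zeroʳ v)
  weight-replicate (suc c) = trans (cong (_+_ v) (weight-replicate c)) (sym (*-suc v c))

  block-parts : ∀ b c → All (λ (a , _) → a ≡ v) (block v b c)
  block-parts true  c = refl ∷ replicate-parts c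
  block-parts false c = replicate-parts c

  block-linked : ∀ b c → Linked Follows (block v b c)
  block-linked true  zero    = [-]
  block-linked true  (suc c) = (≤-refl , λ _ → refl) ∷ replicate-linked (suc c)
  block-linked false c       = replicate-linked c

  weight-block : ∀ b c → weight (block v b c) ≡ markWeight v b + v * c
  weight-block true  c = cong (_+_ v) (weight-replicate c)
  weight-block false c = weight-replicate c

blocks-bounded : ∀ t bs cs → All (λ (a , _) → a ≤ t) (blocks t bs cs)
blocks-bounded zero    _        _        = []
blocks-bounded (suc t) (bs , b) (cs , c) = All.++⁺ (All.map ≤-reflexive (block-parts (suc t) b c))
  (All.map (λ a≤t → ≤-trans a≤t (n≤1+n t)) (blocks-bounded t bs cs))

blocks-overpartition : ∀ t bs cs → Overpartition (blocks t bs cs)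
blocks-overpartition zero    _        _        = [] , []
blocks-overpartition (suc t) (bs , b) (cs , c) =
  All.++⁺ (All.map (λ a≡ → ≤-trans (s≤s z≤n) (≤-reflexive (sym a≡))) (block-parts (suc t) b c)) pos ,
  Linked-Follows-++ (block-linked (suc t) b c) F
    (All.map (λ a≡ → ≤-reflexive (sym a≡)) (block-parts (suc t) b c)) (All.map s≤s (blocks-bounded t bs cs))
  where
  pos = proj₁ (blocks-overpartition t bs cs)
  F = proj₂ (blocks-overpartition t bs cs)

weight-blocks : ∀ t bs cs → weight (blocks t bs cs) ≡ weighted markWeight t bs + weighted _*_ t cs
weight-blocks zero    _        _        = refl
weight-blocks (suc t) (bs , b) (cs , c) = begin
  weight (block (suc t) b c ++ blocks t bs cs)
    ≡⟨ weight-++ (block (suc t) b c) (blocks t bs cs) ⟩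
  weight (block (suc t) b c) + weight (blocks t bs cs)
    ≡⟨ cong₂ _+_ (weight-block (suc t) b c) (weight-blocks t bs cs) ⟩
  (markWeight (suc t) b + suc t * c) + (weighted markWeight t bs + weighted _*_ t cs)
    ≡⟨ interchange +-commutativeSemigroup (markWeight (suc t) b) _ _ _ ⟩
  (markWeight (suc t) b + weighted markWeight t bs) + (suc t * c + weighted _*_ t cs)
    ≡⟨ cong₂ _+_ (+-comm (markWeight (suc t) b) _) (+-comm (suc t * c) _) ⟩
  weighted markWeight (suc t) (bs , b) + weighted _*_ (suc t) (cs , c) ∎
  where open ≡-Reasoning

below-head : ∀ {v} → Linked Follows (x ∷ xs) → proj₁ x < v → All (λ (a , _) → a < v) (x ∷ xs)
below-head F x<v = x<v ∷ All.map (λ a≤x → ≤-trans (s≤s a≤x) x<v) (Follows-≤ F)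

run-replicate : ∀ {v} c R → All (λ (a , _) → a < v) R → run v (replicate c (v , false) ++ R) ≡ (c , R)
run-replicate         zero    []            _          = refl
run-replicate {v}     zero    ((a , o) ∷ R) (a<v ∷ _) with a ≟ v
... | yes a≡v = ⊥-elim (<⇒≢ a<v a≡v)
... | no  _   = refl
run-replicate {v}     (suc c) R             R<v        with v ≟ v
... | yes _   = cong (map₁ suc) (run-replicate c R R<v)
... | no  v≢v = ⊥-elim (v≢v refl)

unblock-block : ∀ {v} b c R → All (λ (a , _) → a < v) R → unblock v (block v b c ++ R) ≡ (b , c , R)
unblock-block {v} true  c       R                 R<v        with v ≟ v
... | yes _   = cong (true ,_) (run-replicate c R R<v)
... | no  v≢v = ⊥-elim (v≢v refl)
unblock-block     false zero    []                _          = refl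
unblock-block {v} false zero    ((a , true) ∷ R)  (a<v ∷ _) with a ≟ v
... | yes a≡v = ⊥-elim (<⇒≢ a<v a≡v)
... | no  _   = refl
unblock-block     false zero    ((a , false) ∷ R) R<v        = cong (false ,_) (run-replicate 0 _ R<v)
unblock-block     false (suc c) R                 R<v        = cong (false ,_) (run-replicate (suc c) R R<v)

unblocks-blocks : ∀ t bs cs → unblocks t (blocks t bs cs) ≡ (bs , cs)
unblocks-blocks zero    _        _        = refl
unblocks-blocks (suc t) (bs , b) (cs , c)
  rewrite unblock-block b c (blocks t bs cs) (All.map s≤s (blocks-bounded t bs cs))
        | unblocks-blocks t bs cs = refl

run-spec : ∀ {v x} L → Linked Follows (x ∷ L) → proj₁ x ≡ v →
           L ≡ replicate (proj₁ (run v L)) (v , false) ++ proj₂ (run v L)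
           × All (λ (a , _) → a < v) (proj₂ (run v L))
run-spec         []            _                  _   = refl , []
run-spec {v} {x} ((a , o) ∷ L) ((a≤x , a≡x⇒o) ∷ F) x≡v with a ≟ v
... | yes a≡v = let L≡ , R<v = run-spec L F a≡v in
                cong₂ _∷_ (cong₂ _,_ a≡v (a≡x⇒o (trans a≡v (sym x≡v)))) L≡ , R<v
... | no  a≢v = refl , below-head F (≤∧≢⇒< (subst (a ≤_) x≡v a≤x) a≢v)

unblock-spec : ∀ {v} L → Linked Follows L → All (λ (a , _) → a ≤ v) L →
               let b , c , R = unblock v L in
               L ≡ block v b c ++ R × All (λ (a , _) → a < v) R
unblock-spec         []               _ _          = refl , []
unblock-spec {v} ((a , true) ∷ L)  F (a≤v ∷ _) with a ≟ v
... | yes a≡v = let L≡ , R<v = run-spec L F a≡v in cong₂ _∷_ (cong (_, true) a≡v) L≡ , R<v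
... | no  a≢v = refl , below-head F (≤∧≢⇒< a≤v a≢v)
unblock-spec {v} ((a , false) ∷ L) F (a≤v ∷ _) with a ≟ v
... | yes a≡v = let L≡ , R<v = run-spec L F a≡v in cong₂ _∷_ (cong (_, false) a≡v) L≡ , R<v
... | no  a≢v = refl , below-head F (≤∧≢⇒< a≤v a≢v)

BoundedOverpartition : ℕ → List Entry → Set
BoundedOverpartition t L = Overpartition L × All (λ (a , _) → a ≤ t) L

blocks-unblocks : ∀ t L → BoundedOverpartition t L → uncurry (blocks t) (unblocks t L) ≡ L
blocks-unblocks zero    []            _                         = refl
blocks-unblocks zero    ((a , _) ∷ _) ((1≤a ∷ _ , _) , a≤0 ∷ _) = ⊥-elim (1+n≰n (≤-trans 1≤a a≤0))
blocks-unblocks (suc t) L             ((pos , F) , L≤)          =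
  trans (cong (block (suc t) b c ++_) (blocks-unblocks t R ((posR , FR) , R≤t))) (sym L≡)
  where
  b = proj₁ (unblock (suc t) L)
  c = proj₁ (proj₂ (unblock (suc t) L))
  R = proj₂ (proj₂ (unblock (suc t) L))
  L≡ = proj₁ (unblock-spec L F L≤)
  posR = All.++⁻ʳ (block (suc t) b c) (subst (All _) L≡ pos)
  FR = Linked-++⁻ʳ (block (suc t) b c) (subst (Linked Follows) L≡ F)
  R≤t = All.map ≤-pred (proj₂ (unblock-spec L F L≤))

blocks-bijection : ∀ t → SizedBijection (λ (bs , cs) → weighted markWeight t bs + weighted _*_ t cs)
                                        (λ _ → ⊤ × ⊤) weight (BoundedOverpartition t)
blocks-bijection t = record
  { encode        = uncurry (blocks t)
  ; decode        = unblocks t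
  ; encode-pres   = λ {(bs , cs)} _ → blocks-overpartition t bs cs , blocks-bounded t bs cs
  ; decode-pres   = λ _ → tt , tt
  ; encode-size   = λ {(bs , cs)} _ → weight-blocks t bs cs
  ; decode∘encode = λ {(bs , cs)} _ → unblocks-blocks t bs cs
  ; encode∘decode = blocks-unblocks t _
  }

Counts-BoundedOverpartition : ∀ t → Counts weight (BoundedOverpartition t) (negQPoch t *ₛ invQPoch t)
Counts-BoundedOverpartition t =
  Counts-transport (blocks-bijection t) (Counts-* (Counts-negQPoch t) (Counts-invQPoch t))

module _ (t : ℕ) .{{_ : NonZero t}} where

  shift unshift : Entry → Entry
  shift   (a , o) = a + t , o
  unshift (a , o) = a ∸ t , o

  shift-unshift : t ≤ proj₁ x → shift (unshift x) ≡ x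
  shift-unshift t≤a = cong (_, _) (m∸n+n≡m t≤a)

  unshift-shift : ∀ x → unshift (shift x) ≡ x
  unshift-shift (a , _) = cong (_, _) (m+n∸n≡m a t)

  Follows-shift⁺ : Follows x y → Follows (shift x) (shift y)
  Follows-shift⁺ (b≤a , b≡a⇒o) = +-monoˡ-≤ t b≤a , b≡a⇒o ∘ +-cancelʳ-≡ _ _ _

  Follows-shift⁻ : Follows (shift x) (shift y) → Follows x y
  Follows-shift⁻ (b≤a , b≡a⇒o) = +-cancelʳ-≤ t _ _ b≤a , λ b≡a → b≡a⇒o (cong (_+ t) b≡a)

  Follows-shift-self : ∀ x → Follows (shift x) x
  Follows-shift-self x = Follows-< {y = x} {x = shift x} (m<m+n (proj₁ x) (>-nonZero⁻¹ t))

  -- The overpartitions counted by g_t: the chain condition also holds cyclically, from the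
  -- smallest part raised by t back to the largest part.
  Cyclic : List Entry → Set
  Cyclic []       = ⊥
  Cyclic (x ∷ xs) = Overpartition (x ∷ xs) × Follows (shift (last′ x xs)) x

  liftSmallest : List Entry → List Entry
  liftSmallest []       = []
  liftSmallest (x ∷ xs) = shift (last′ x xs) ∷ init′ x xs

  lowerLargest : List Entry → List Entry
  lowerLargest []       = []
  lowerLargest (x ∷ xs) = xs ∷ʳ unshift x

  liftSmallest-∷ʳ : ∀ xs y → liftSmallest (xs ∷ʳ y) ≡ shift y ∷ xs
  liftSmallest-∷ʳ []       y = refl
  liftSmallest-∷ʳ (x ∷ xs) y = cong₂ (λ z zs → shift z ∷ zs) (last′-∷ʳ x xs y) (init′-∷ʳ x xs y)

  liftSmallest-lowerLargest : ∀ xs → t ≤ proj₁ x → liftSmallest (lowerLargest (x ∷ xs)) ≡ x ∷ xs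
  liftSmallest-lowerLargest xs t≤x = trans (liftSmallest-∷ʳ xs _) (cong (_∷ xs) (shift-unshift t≤x))

  lowerLargest-liftSmallest : ∀ x xs → lowerLargest (liftSmallest (x ∷ xs)) ≡ x ∷ xs
  lowerLargest-liftSmallest x xs =
    trans (cong (init′ x xs ∷ʳ_) (unshift-shift (last′ x xs))) (sym (∷-init′-last′ x xs))

  weight-shift∷ : ∀ xs y → weight (shift y ∷ xs) ≡ weight (xs ∷ʳ y) + t
  weight-shift∷ xs (a , _) = begin
    (a + t) + weight xs  ≡⟨ +-comm (a + t) _ ⟩
    weight xs + (a + t)  ≡⟨ +-assoc (weight xs) a t ⟨
    weight xs + a + t    ≡⟨ cong (_+ t) (weight-∷ʳ xs (a , _)) ⟨
    weight (xs ∷ʳ (a , _)) + t ∎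
    where open ≡-Reasoning

  Cyclic-shift∷ : ∀ xs y → Cyclic (xs ∷ʳ y) → Cyclic (shift y ∷ xs)
  Cyclic-shift∷ []       y ((1≤y ∷ [] , _) , _) =
    (≤-trans 1≤y (m≤m+n _ t) ∷ [] , [-]) , Follows-shift-self (shift y)
  Cyclic-shift∷ (x ∷ xs) y ((pos , F) , last≺x) =
    (≤-trans 1≤y (m≤m+n _ t) ∷ pos-x∷xs , y≺x ∷ F-x∷xs) , Follows-shift⁺ {x = last′ x xs} last≺y
    where
    pos-x∷xs = proj₁ (All.∷ʳ⁻ {xs = x ∷ xs} pos)
    1≤y = proj₂ (All.∷ʳ⁻ {xs = x ∷ xs} pos)
    F-x∷xs = proj₁ (Linked-∷ʳ⁻ xs F)
    last≺y = proj₂ (Linked-∷ʳ⁻ xs F)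
    y≺x : Follows (shift y) x
    y≺x = subst (λ z → Follows (shift z) x) (last′-∷ʳ x xs y) last≺x

  lowerLargest-cyclic : ∀ xs → t < proj₁ x → Cyclic (x ∷ xs) → Cyclic (lowerLargest (x ∷ xs))
  lowerLargest-cyclic     []       t<x _ = (m<n⇒0<n∸m t<x ∷ [] , [-]) , Follows-shift-self _
  lowerLargest-cyclic {x} (y ∷ xs) t<x ((_ ∷ pos , F) , last≺x) =
    (All.∷ʳ⁺ pos (m<n⇒0<n∸m t<x) , Linked-∷ʳ⁺ (Linked.tail F) last≺x′) ,
    subst (λ z → Follows (shift z) y) (sym (last′-∷ʳ y xs (unshift x))) x′≺y
    where
    x≡ = sym (shift-unshift (<⇒≤ t<x))
    last≺x′ : Follows (last′ y xs) (unshift x)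
    last≺x′ = Follows-shift⁻ {x = last′ y xs} (subst (Follows (shift (last′ y xs))) x≡ last≺x)
    x′≺y : Follows (shift (unshift x)) y
    x′≺y = subst (λ z → Follows z y) x≡ (Linked.head F)

  liftSmallest-cyclic : ∀ L → Cyclic L → Cyclic (liftSmallest L)
  liftSmallest-cyclic (x ∷ xs) c = Cyclic-shift∷ (init′ x xs) (last′ x xs) (subst Cyclic (∷-init′-last′ x xs) c)

  weight-liftSmallest : ∀ L → Cyclic L → weight (liftSmallest L) ≡ weight L + t
  weight-liftSmallest (x ∷ xs) _ =
    trans (weight-shift∷ (init′ x xs) (last′ x xs)) (cong (λ L → weight L + t) (sym (∷-init′-last′ x xs)))

  weight-lowerLargest : ∀ xs → t ≤ proj₁ x → weight (lowerLargest (x ∷ xs)) + t ≡ weight (x ∷ xs)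
  weight-lowerLargest {x} xs t≤x = trans (sym (weight-shift∷ xs _)) (cong (weight ∘ (_∷ xs)) (shift-unshift {x = x} t≤x))

  weight-pos : ∀ L → Cyclic L → 1 ≤ weight L
  weight-pos (x ∷ xs) ((1≤x ∷ _ , _) , _) = ≤-trans 1≤x (m≤m+n _ _)

  lifts : ℕ → List Entry → List Entry
  lifts zero    L = L
  lifts (suc m) L = liftSmallest (lifts m L)

  lifts-cyclic : ∀ m {L} → Cyclic L → Cyclic (lifts m L)
  lifts-cyclic zero    c = c
  lifts-cyclic (suc m) c = liftSmallest-cyclic _ (lifts-cyclic m c)

  weight-lifts : ∀ m {L} → Cyclic L → weight (lifts m L) ≡ t * m + weight L
  weight-lifts zero    {L} _ = cong (_+ weight L) (sym (*-zeroʳ t))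
  weight-lifts (suc m) {L} c = begin
    weight (liftSmallest (lifts m L)) ≡⟨ weight-liftSmallest _ (lifts-cyclic m c) ⟩
    weight (lifts m L) + t            ≡⟨ cong (_+ t) (weight-lifts m c) ⟩
    t * m + weight L + t              ≡⟨ +-comm _ t ⟩
    t + (t * m + weight L)            ≡⟨ +-assoc t (t * m) _ ⟨
    t + t * m + weight L              ≡⟨ cong (_+ weight L) (*-suc t m) ⟨
    t * suc m + weight L ∎
    where open ≡-Reasoning

  -- Each step lowers the weight by t ≥ 1, so the fuel weight L suffices.
  lower : ℕ → List Entry → ℕ × List Entry
  lower zero       L        = 0 , L
  lower (suc fuel) []       = 0 , []
  lower (suc fuel) (x ∷ xs) with t <? proj₁ x
  ... | yes _ = map₁ suc (lower fuel (lowerLargest (x ∷ xs)))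
  ... | no  _ = 0 , x ∷ xs

  Reduced : List Entry → Set
  Reduced L = Cyclic L × All (λ (a , _) → a ≤ t) L

  m+t≤1+n⇒m≤n : ∀ {m n} → m + t ≤ suc n → m ≤ n
  m+t≤1+n⇒m≤n {m} m+t≤1+n = ≤-pred (≤-trans (m<m+n m (>-nonZero⁻¹ t)) m+t≤1+n)

  lower-spec : ∀ fuel L → Cyclic L → weight L ≤ fuel →
               Reduced (proj₂ (lower fuel L)) × uncurry lifts (lower fuel L) ≡ L
  lower-spec zero       L        c w≤0 = ⊥-elim (1+n≰n (≤-trans (weight-pos L c) w≤0))
  lower-spec (suc fuel) (x ∷ xs) c w≤ with t <? proj₁ x
  ... | yes t<x =
    let reduced , lifts≡ = lower-spec fuel (lowerLargest (x ∷ xs)) (lowerLargest-cyclic xs t<x c)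
                             (m+t≤1+n⇒m≤n (subst (_≤ suc fuel) (sym (weight-lowerLargest xs (<⇒≤ t<x))) w≤))
    in reduced , trans (cong liftSmallest lifts≡) (liftSmallest-lowerLargest xs (<⇒≤ t<x))
  ... | no  t≮x = (c , x≤t ∷ All.map (λ b≤x → ≤-trans b≤x x≤t) (Follows-≤ (proj₂ (proj₁ c)))) , refl
    where x≤t = ≮⇒≥ t≮x

  All-last′ : ∀ {P : A → Set} xs → All P (x ∷ xs) → P (last′ x xs)
  All-last′ []       (px ∷ []) = px
  All-last′ (y ∷ xs) (_ ∷ pys) = All-last′ xs pys

  lower-liftSmallest : ∀ fuel L → Cyclic L → lower (suc fuel) (liftSmallest L) ≡ map₁ suc (lower fuel L)
  lower-liftSmallest fuel (x ∷ xs) ((pos , _) , _) with t <? proj₁ (last′ x xs) + t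
  ... | yes _   = cong (map₁ suc ∘ lower fuel) (lowerLargest-liftSmallest x xs)
  ... | no  t≮ = ⊥-elim (t≮ (+-monoˡ-≤ t (All-last′ xs pos)))

  lower-lifts : ∀ m fuel {L} → Reduced L → weight (lifts m L) ≤ fuel → lower fuel (lifts m L) ≡ (m , L)
  lower-lifts m       zero       (c , _) w≤0 = ⊥-elim (1+n≰n (≤-trans (weight-pos _ (lifts-cyclic m c)) w≤0))
  lower-lifts zero    (suc fuel) {x ∷ xs} (_ , x≤t ∷ _) _ with t <? proj₁ x
  ... | yes t<x = ⊥-elim (<⇒≱ t<x x≤t)
  ... | no  _   = refl
  lower-lifts (suc m) (suc fuel) r@(c , _) w≤ = trans (lower-liftSmallest fuel _ (lifts-cyclic m c))
    (cong (map₁ suc) (lower-lifts m fuel r (m+t≤1+n⇒m≤n (subst (_≤ suc fuel) (weight-liftSmallest _ (lifts-cyclic m c)) w≤))))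

  Reduced⇔BoundedOverpartition : ∀ L → Reduced L ⇔ (BoundedOverpartition t L × 1 ≤ weight L)
  Reduced⇔BoundedOverpartition L = mk⇔ (λ (c , L≤t) → (cyclic L c , L≤t) , weight-pos L c) (⇐ L)
    where
    cyclic : ∀ L → Cyclic L → Overpartition L
    cyclic (_ ∷ _) = proj₁
    ⇐ : ∀ L → BoundedOverpartition t L × 1 ≤ weight L → Reduced L
    ⇐ (x ∷ xs) ((ov@(pos , _) , L≤t@(x≤t ∷ _)) , _) =
      (ov , Follows-< {y = x} {x = shift (last′ x xs)} (≤-trans (s≤s x≤t) (+-monoˡ-≤ t (All-last′ xs pos)))) , L≤t

  lifts-bijection : SizedBijection (λ (m , μ) → t * m + weight μ)
                                   (λ (_ , μ) → ⊤ × (BoundedOverpartition t μ × 1 ≤ weight μ))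
                                   weight Cyclic
  lifts-bijection = record
    { encode        = uncurry lifts
    ; decode        = λ L → lower (weight L) L
    ; encode-pres   = λ {(m , _)} (_ , b) → lifts-cyclic m (proj₁ (reduced b))
    ; decode-pres   = λ {L} c → tt , to (Reduced⇔BoundedOverpartition _) (proj₁ (lower-spec _ L c ≤-refl))
    ; encode-size   = λ {(m , _)} (_ , b) → weight-lifts m (proj₁ (reduced b))
    ; decode∘encode = λ {(m , _)} (_ , b) → lower-lifts m _ (reduced b) ≤-refl
    ; encode∘decode = λ {L} c → proj₂ (lower-spec _ L c ≤-refl)
    }
    where
    reduced : ∀ {μ} → BoundedOverpartition t μ × 1 ≤ weight μ → Reduced μ
    reduced = from (Reduced⇔BoundedOverpartition _)

  Counts-Cyclic : Counts weight Cyclic (rhs t)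
  Counts-Cyclic = Counts-transport lifts-bijection
    (Counts-* (Counts-geom t) (Counts-positive [] (([] , []) , []) refl only-[] (Counts-BoundedOverpartition t)))
    where
    only-[] : ∀ {μ} → BoundedOverpartition t μ → weight μ ≡ 0 → μ ≡ []
    only-[] {[]}    _                   _   = refl
    only-[] {x ∷ _} ((1≤x ∷ _ , _) , _) w≡0 = ⊥-elim (1+n≰n (subst (1 ≤_) w≡0 (≤-trans 1≤x (m≤m+n _ _))))

  IsGOverpartition⇔Cyclic : ∀ {n} L → 1 ≤ n → IsGOverpartition t n L ⇔ (Cyclic L × weight L ≡ n)
  IsGOverpartition⇔Cyclic []       1≤n =
    mk⇔ (λ ((_ , _ , _ , 0≡n) , _) → ⊥-elim (1+n≰n (subst (1 ≤_) (sym 0≡n) 1≤n))) λ ()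
  IsGOverpartition⇔Cyclic {n} (x ∷ xs) _ = mk⇔ ⇒ ⇐
    where
    a = proj₁ x
    s = proj₁ (last′ x xs)

    spread≡ : Linked Follows (x ∷ xs) → largest (x ∷ xs) ∸ smallest (x ∷ xs) ≡ a ∸ s
    spread≡ F = cong₂ _∸_ (largest-head F) (smallest-last′ xs F)

    ⇒ : IsGOverpartition t n (x ∷ xs) → Cyclic (x ∷ xs) × weight (x ∷ xs) ≡ n
    ⇒ (isOv , spread≤t , spread≡t⇒) = (ov , x≤s+t , x≡s+t⇒o) , w
      where
      ov = proj₁ (to (IsOverpartition⇔ (x ∷ xs)) isOv)
      w = proj₂ (to (IsOverpartition⇔ (x ∷ xs)) isOv)
      F = proj₂ ov
      x≤s+t : a ≤ s + t
      x≤s+t = ≤-trans (m≤n+m∸n a s) (+-monoʳ-≤ s (subst (_≤ t) (spread≡ F) spread≤t))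
      x≡s+t⇒o : a ≡ s + t → proj₂ x ≡ false
      x≡s+t⇒o a≡ with px ∷ _ ← spread≡t⇒ (trans (spread≡ F) (trans (cong (_∸ s) a≡) (m+n∸m≡n s t)))
        = px (sym (largest-head F))

    ⇐ : Cyclic (x ∷ xs) × weight (x ∷ xs) ≡ n → IsGOverpartition t n (x ∷ xs)
    ⇐ ((ov@(_ , F) , x≤s+t , x≡s+t⇒o) , w) = from (IsOverpartition⇔ (x ∷ xs)) (ov , w) , spread≤t , spread≡t⇒
      where
      spread≤t = subst (_≤ t) (sym (spread≡ F)) (m≤n+o⇒m∸n≤o a s x≤s+t)
      spread≡t⇒ : largest (x ∷ xs) ∸ smallest (x ∷ xs) ≡ t →
                  All (λ (b , o) → b ≡ largest (x ∷ xs) → o ≡ false) (x ∷ xs)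
      spread≡t⇒ d≡t = subst (λ ℓ → All (λ (b , o) → b ≡ ℓ → o ≡ false) (x ∷ xs)) (sym (largest-head F))
        ((λ _ → x≡s+t⇒o x≡s+t) ∷ All.map (λ a≤b⇒o b≡a → a≤b⇒o (≤-reflexive (sym b≡a))) (repeats-unmarked F))
        where
        x≡s+t : a ≡ s + t
        x≡s+t = trans (sym (m+[n∸m]≡n (last′-≤ xs F))) (cong (_+_ s) (trans (sym (spread≡ F)) d≡t))

theorem1 : (t : ℕ) → 1 ≤ t → (n : ℕ) → 1 ≤ n →
    Σ ℕ (λ k → G t n k × + k ≡ rhs t n)
theorem1 (suc t) _ n 1≤n =
  let k , count , k≡ = Counts-Cyclic (suc t) n
  in k , HasCount-resp (λ L → ⇔-sym (IsGOverpartition⇔Cyclic (suc t) L 1≤n)) count , k≡
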